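{- Let $T$ be an $n$-tournament and $u\notin V(T)$. (i) If $T$ is a $1$-tournament, a $2$-tournament or a diamond, then for every dominating relation $\sigma$ between $u$ and $V(T)$, $u$ is a CR vertex for $T$ with $\sigma$. (ii) If $n\geq 3$ and $T$ is not a diamond, then there exists a dominating relation $\sigma$ between $u$ and $V(T)$ such that $u$ is a non-CR vertex for $T$ with $\sigma$.
   Context: A tournament is a digraph with exactly one arc between each pair of distinct vertices; an $n$-tournament has $n$ vertices. For distinct vertices write $\theta_T(u,v)=1$ if $u\to v$, $-1$ otherwise. A diamond is a 4-tournament consisting of a 3-cycle plus a vertex dominating all of it or dominated by all of it. Two vertices $u_1,u_2$ of a tournament $T$ are both covertices and revertices if $|V(T)|=2$; if $|V(T)|\ge3$ they are covertices if $\theta_T(u_1,v)=\theta_T(u_2,v)$ for all other $v$, revertices if $\theta_T(u_1,v)=-\theta_T(u_2,v)$ for all other $v$; CR-associated if covertices or revertices. A dominating relation between $u\notin V(T)=\{v_1,\dots,v_n\}$ and $V(T)$ is $\sigma=(r_1,\dots,r_n)\in\{1,-1\}^n$; $T(u,\sigma)$ is the tournament on $V(T)\cup\{u\}$ extending $T$ with $u\to v_i$ iff $r_i=1$. $u$ is a CR vertex for $T$ with $\sigma$ if there is $v\in V(T)$ such that $u,v$ are CR-associated in $T(u,\sigma)$; otherwise $u$ is a non-CR vertex for $T$ with $\sigma$. -}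

module Defs where

open import Data.Nat using (ℕ; zero; suc; _≥_)
open import Data.Fin using (Fin; zero; suc)
open import Data.Bool using (Bool; true; false; not)
open import Data.Product using (_×_; ∃; ∃-syntax)
open import Data.Sum using (_⊎_)
open import Relation.Binary.PropositionalEquality using (_≡_; _≢_)

-- An n-tournament on vertex set Fin n.  arc u v = true means u → v.
-- Between distinct vertices exactly one arc: arc v u = not (arc u v).
-- (The diagonal value arc u u is irrelevant and never used.)
record Tournament (n : ℕ) : Set where
  field
    arc     : Fin n → Fin n → Bool
    oneArc  : ∀ u v → u ≢ v → arc v u ≡ not (arc u v)
open Tournament public

_⟶[_]_ : ∀ {n} → Fin n → Tournament n → Fin n → Set
u ⟶[ T ] v = arc T u v ≡ true

IsDiamond : ∀ {n} → Tournament n → Set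
IsDiamond {n} T =
  n ≡ 4 ×
  ∃[ a ] ∃[ b ] ∃[ c ] ∃[ d ]
    (a ≢ b × a ≢ c × a ≢ d × b ≢ c × b ≢ d × c ≢ d) ×
    (a ⟶[ T ] b × b ⟶[ T ] c × c ⟶[ T ] a) ×
    ((d ⟶[ T ] a × d ⟶[ T ] b × d ⟶[ T ] c) ⊎
     (a ⟶[ T ] d × b ⟶[ T ] d × c ⟶[ T ] d))

Covertices : ∀ {n} → Tournament n → Fin n → Fin n → Set
Covertices T u₁ u₂ = ∀ v → v ≢ u₁ → v ≢ u₂ → arc T u₁ v ≡ arc T u₂ v

Revertices : ∀ {n} → Tournament n → Fin n → Fin n → Set
Revertices T u₁ u₂ = ∀ v → v ≢ u₁ → v ≢ u₂ → arc T u₁ v ≡ not (arc T u₂ v)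

CRAssociated : ∀ {n} → Tournament n → Fin n → Fin n → Set
CRAssociated {n} T u₁ u₂ =
  u₁ ≢ u₂ × (n ≡ 2 ⊎ (n ≥ 3 × (Covertices T u₁ u₂ ⊎ Revertices T u₁ u₂)))

-- A dominating relation between a new vertex u and V(T) = Fin n:
-- σ i = true iff u → v_i  (i.e. r_i = 1).
DominatingRelation : ℕ → Set
DominatingRelation n = Fin n → Bool

-- T(u,σ): vertex set Fin (suc n), where zero is the new vertex u and suc i is v_i.
extArc : ∀ {n} → Tournament n → DominatingRelation n → Fin (suc n) → Fin (suc n) → Bool
extArc T σ zero    zero    = false
extArc T σ zero    (suc j) = σ j
extArc T σ (suc i) zero    = not (σ i)
extArc T σ (suc i) (suc j) = arc T i j

private
  not-not : ∀ b → b ≡ not (not b)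
  not-not true  = _≡_.refl
  not-not false = _≡_.refl

  extOne : ∀ {n} (T : Tournament n) σ u v → u ≢ v → extArc T σ v u ≡ not (extArc T σ u v)
  extOne T σ zero    zero    ne = Data.Empty.⊥-elim (ne _≡_.refl)
    where import Data.Empty
  extOne T σ zero    (suc j) ne = _≡_.refl
  extOne T σ (suc i) zero    ne = not-not (σ i)
  extOne T σ (suc i) (suc j) ne = oneArc T i j (λ e → ne (Relation.Binary.PropositionalEquality.cong suc e))
    where import Relation.Binary.PropositionalEquality

extend : ∀ {n} → Tournament n → DominatingRelation n → Tournament (suc n)
extend T σ = record { arc = extArc T σ ; oneArc = extOne T σ }

IsCRVertex : ∀ {n} → Tournament n → DominatingRelation n → Set
IsCRVertex T σ = ∃[ v ] CRAssociated (extend T σ) zero (suc v)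

{-# OPTIONS --safe #-}
module Submission where

open import Defs
open import Data.Nat using (ℕ; _≥_)
open import Data.Product using (_×_; ∃-syntax)
open import Data.Sum using (_⊎_)
open import Relation.Nullary using (¬_)
open import Relation.Binary.PropositionalEquality using (_≡_)

open import Data.Bool using (Bool; true; false; not; _xor_)
import Data.Bool.Properties as Bool
open import Data.Empty using (⊥-elim)
open import Data.Fin using (Fin; zero; suc; _≟_; combine; funToFin; finToFun)
open import Data.Fin.Properties
  using (any?; all?; ¬∀⟶∃¬; 2↔Bool; suc-injective; combine-injective; injective⇒≤;
         funToFin-finToFin; finToFun-funToFin)
open import Data.Nat using (suc; _*_; _^_; _+_; _<_; _≤_; s≤s)
import Data.Nat.Properties as ℕ
open import Data.Product using (_,_; proj₁; proj₂; Σ-syntax)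
open import Data.Sum using (inj₁; inj₂; [_,_])
open import Data.Unit using (tt)
open import Data.Vec.Functional using (updateAt)
open import Data.Vec.Functional.Properties using (updateAt-updates; updateAt-minimal)
open import Function using (_∘_; id; const; _⇔_; mk⇔; Injection; Inverse; Equivalence)
open import Function.Properties.Inverse using (↔⇒↣)
open import Function.Construct.Symmetry using (↔-sym)
open import Relation.Binary.Definitions using (_Respects_)
open import Relation.Binary.PropositionalEquality
  using (_≢_; refl; sym; trans; cong; cong₂; _≗_; module ≡-Reasoning)
open import Relation.Nullary using (Dec; yes; no)
open import Relation.Nullary.Decidable using (toWitness; ¬?; map′; _×-dec_; _⊎-dec_; _→-dec_)

-- In T(u,σ), u and v are covertices (revertices) iff σ agrees with the out-neighbourhood
-- of v (with its complement) at every vertex other than v.  So σ is determined by v, the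
-- kind of association and σ(v): at most 4n of the 2^n relations make u a CR vertex, and
-- 4n < 2^n once n ≥ 5.  For n = 2 the vertex other than v either agrees or disagrees.
-- The cases n = 3, 4 are settled by exhaustive search, every tournament on n + 1
-- vertices being, up to its irrelevant diagonal, an extension of one on n vertices.

private
  variable
    m n : ℕ

-- A record, not a function type, so that T and T′ are inferable from a proof of T ≈ T′.
infix 4 _≈_
record _≈_ (T T′ : Tournament n) : Set where
  constructor sameArcs
  field
    arc-≡ : ∀ i j → i ≢ j → arc T i j ≡ arc T′ i j
open _≈_

≈-refl : {T : Tournament n} → T ≈ T
≈-refl = sameArcs λ _ _ _ → refl

≈-sym : {T T′ : Tournament n} → T ≈ T′ → T′ ≈ T
≈-sym T≈T′ = sameArcs λ i j i≢j → sym (arc-≡ T≈T′ i j i≢j)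

extend-cong : {T T′ : Tournament n} {σ σ′ : DominatingRelation n} →
              T ≈ T′ → σ ≗ σ′ → extend T σ ≈ extend T′ σ′
extend-cong T≈T′ σ≗σ′ = sameArcs λ where
  zero    zero    0≢0 → ⊥-elim (0≢0 refl)
  zero    (suc j) _   → σ≗σ′ j
  (suc i) zero    _   → cong not (σ≗σ′ i)
  (suc i) (suc j) i≢j → arc-≡ T≈T′ i j (i≢j ∘ cong suc)

≈-transport : {T T′ : Tournament n} → T ≈ T′ → (f : Bool → Bool) → ∀ {x y v} → v ≢ x → v ≢ y →
              arc T x v ≡ f (arc T y v) → arc T′ x v ≡ f (arc T′ y v)
≈-transport T≈T′ f {x} {y} {v} v≢x v≢y eq =
  trans (sym (arc-≡ T≈T′ x v (v≢x ∘ sym))) (trans eq (cong f (arc-≡ T≈T′ y v (v≢y ∘ sym))))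

crAssociated-resp : ∀ {x y} → (λ T → CRAssociated {n} T x y) Respects _≈_
crAssociated-resp _    (x≢y , inj₁ n≡2)              = x≢y , inj₁ n≡2
crAssociated-resp T≈T′ (x≢y , inj₂ (n≥3 , inj₁ co)) =
  x≢y , inj₂ (n≥3 , inj₁ λ v v≢x v≢y → ≈-transport T≈T′ id v≢x v≢y (co v v≢x v≢y))
crAssociated-resp T≈T′ (x≢y , inj₂ (n≥3 , inj₂ re)) =
  x≢y , inj₂ (n≥3 , inj₂ λ v v≢x v≢y → ≈-transport T≈T′ not v≢x v≢y (re v v≢x v≢y))

isCRVertex-resp : {T T′ : Tournament n} {σ σ′ : DominatingRelation n} →
                  T ≈ T′ → σ ≗ σ′ → IsCRVertex T σ → IsCRVertex T′ σ′
isCRVertex-resp T≈T′ σ≗σ′ (v , cr) = v , crAssociated-resp (extend-cong T≈T′ σ≗σ′) cr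

isDiamond-resp : IsDiamond {n} Respects _≈_
isDiamond-resp {x = T} {T′} T≈T′
  (n≡4 , a , b , c , d , ≢s@(a≢b , a≢c , a≢d , b≢c , b≢d , c≢d) , (ab , bc , ca) , apex) =
  n≡4 , a , b , c , d , ≢s , (⟶ a≢b ab , ⟶ b≢c bc , ⟶ (a≢c ∘ sym) ca) ,
  [ (λ (da , db , dc) → inj₁ (⟶ (a≢d ∘ sym) da , ⟶ (b≢d ∘ sym) db , ⟶ (c≢d ∘ sym) dc))
  , (λ (ad , bd , cd) → inj₂ (⟶ a≢d ad , ⟶ b≢d bd , ⟶ c≢d cd)) ] apex
  where
  ⟶ : ∀ {x y} → x ≢ y → x ⟶[ T ] y → x ⟶[ T′ ] y
  ⟶ {x} {y} x≢y = trans (sym (arc-≡ T≈T′ x y x≢y))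

AllCR : Tournament n → Set
AllCR T = ∀ σ → IsCRVertex T σ

allCR-resp : AllCR {n} Respects _≈_
allCR-resp T≈T′ all σ = isCRVertex-resp T≈T′ (λ _ → refl) (all σ)

covertices? : (T : Tournament n) → ∀ x y → Dec (Covertices T x y)
covertices? T x y =
  all? λ v → ¬? (v ≟ x) →-dec ¬? (v ≟ y) →-dec arc T x v Bool.≟ arc T y v

revertices? : (T : Tournament n) → ∀ x y → Dec (Revertices T x y)
revertices? T x y =
  all? λ v → ¬? (v ≟ x) →-dec ¬? (v ≟ y) →-dec arc T x v Bool.≟ not (arc T y v)

crAssociated? : (T : Tournament n) → ∀ x y → Dec (CRAssociated T x y)
crAssociated? {n} T x y =
  ¬? (x ≟ y) ×-dec (n ℕ.≟ 2 ⊎-dec (3 ℕ.≤? n ×-dec (covertices? T x y ⊎-dec revertices? T x y)))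

isCRVertex? : (T : Tournament n) → ∀ σ → Dec (IsCRVertex T σ)
isCRVertex? T σ = any? λ v → crAssociated? (extend T σ) zero (suc v)

isDiamond? : (T : Tournament n) → Dec (IsDiamond T)
isDiamond? {n} T =
  n ℕ.≟ 4 ×-dec
  (any? λ a → any? λ b → any? λ c → any? λ d →
    (a ≢? b ×-dec a ≢? c ×-dec a ≢? d ×-dec b ≢? c ×-dec b ≢? d ×-dec c ≢? d) ×-dec
    (a ⟶? b ×-dec b ⟶? c ×-dec c ⟶? a) ×-dec
    ((d ⟶? a ×-dec d ⟶? b ×-dec d ⟶? c) ⊎-dec (a ⟶? d ×-dec b ⟶? d ×-dec c ⟶? d)))
  where
  _≢?_ : ∀ x y → Dec (x ≢ y)
  x ≢? y = ¬? (x ≟ y)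
  _⟶?_ : ∀ x y → Dec (x ⟶[ T ] y)
  x ⟶? y = arc T x y Bool.≟ true

bit : Bool → Fin 2
bit = Inverse.from 2↔Bool

bit-injective : ∀ {r s} → bit r ≡ bit s → r ≡ s
bit-injective = Injection.injective (↔⇒↣ (↔-sym 2↔Bool))

bool : Fin 2 → Bool
bool = Inverse.to 2↔Bool

bool-injective : ∀ {i j} → bool i ≡ bool j → i ≡ j
bool-injective = Injection.injective (↔⇒↣ 2↔Bool)

relation : Fin (2 ^ n) → DominatingRelation n
relation {n} i = bool ∘ finToFun {2} {n} i

code : DominatingRelation n → Fin (2 ^ n)
code σ = funToFin (bit ∘ σ)

relation-code : (σ : DominatingRelation n) → relation (code σ) ≗ σ
relation-code σ k = begin
  bool (finToFun (funToFin (bit ∘ σ)) k) ≡⟨ cong bool (finToFun-funToFin (bit ∘ σ) k) ⟩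
  bool (bit (σ k))                        ≡⟨ Inverse.strictlyInverseˡ 2↔Bool (σ k) ⟩
  σ k                                     ∎
  where open ≡-Reasoning

funToFin-cong : {f g : Fin n → Fin m} → f ≗ g → funToFin f ≡ funToFin g
funToFin-cong {n = 0}     f≗g = refl
funToFin-cong {n = suc n} f≗g = cong₂ combine (f≗g zero) (funToFin-cong (f≗g ∘ suc))

relation-injective : (i j : Fin (2 ^ n)) → relation i ≗ relation j → i ≡ j
relation-injective {n} i j eq = begin
  i                             ≡⟨ funToFin-finToFin {n} {2} i ⟨
  funToFin (finToFun {2} {n} i) ≡⟨ funToFin-cong {n} (bool-injective ∘ eq) ⟩
  funToFin (finToFun {2} {n} j) ≡⟨ funToFin-finToFin {n} {2} j ⟩
  j                             ∎
  where open ≡-Reasoning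

∀-relation : ∀ {P : DominatingRelation n → Set} → P Respects _≗_ →
             (∀ i → P (relation i)) → ∀ σ → P σ
∀-relation resp all σ = resp (relation-code σ) (all (code σ))

∀-relation? : ∀ {P : DominatingRelation n → Set} → P Respects _≗_ →
              (∀ σ → Dec (P σ)) → Dec (∀ σ → P σ)
∀-relation? resp P? = map′ (∀-relation resp) (_∘ relation) (all? (P? ∘ relation))

allCR? : (T : Tournament n) → Dec (AllCR T)
allCR? T = ∀-relation? (isCRVertex-resp ≈-refl) (isCRVertex? T)

¬allCR⇒nonCR : (T : Tournament n) → ¬ AllCR T → ∃[ σ ] ¬ IsCRVertex T σ
¬allCR⇒nonCR {n} T ¬all =
  let i , ¬cr = ¬∀⟶∃¬ (2 ^ n) _ (isCRVertex? T ∘ relation)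
                  (¬all ∘ ∀-relation (isCRVertex-resp ≈-refl))
  in relation i , ¬cr

tournament₀ : Tournament 0
tournament₀ = record { arc = λ () ; oneArc = λ () }

remove₀ : Tournament (suc n) → Tournament n
remove₀ T = record
  { arc    = λ i j → arc T (suc i) (suc j)
  ; oneArc = λ i j i≢j → oneArc T (suc i) (suc j) (i≢j ∘ suc-injective)
  }

row₀ : Tournament (suc n) → DominatingRelation n
row₀ T j = arc T zero (suc j)

extend-remove₀ : (T : Tournament (suc n)) → extend (remove₀ T) (row₀ T) ≈ T
extend-remove₀ T = sameArcs λ where
  zero    zero    0≢0 → ⊥-elim (0≢0 refl)
  zero    (suc j) _   → refl
  (suc i) zero    _   → sym (oneArc T zero (suc i) λ ())
  (suc i) (suc j) _   → refl

∀-tournament? : ∀ {P : Tournament n → Set} → P Respects _≈_ →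
                (∀ T → Dec (P T)) → Dec (∀ T → P T)
∀-tournament? {n = 0}     resp P? =
  map′ (λ p T → resp (sameArcs λ ()) p) (λ all → all tournament₀) (P? tournament₀)
∀-tournament? {n = suc n} resp P? =
  map′ (λ all T → resp (extend-remove₀ T) (all (remove₀ T) (row₀ T)))
       (λ all T σ → all (extend T σ))
       (∀-tournament? (λ T≈T′ all σ → resp (extend-cong T≈T′ (λ _ → refl)) (all σ)) λ T →
          ∀-relation? (resp ∘ extend-cong ≈-refl) (P? ∘ extend T))

allCR₂ : (T : Tournament 2) → AllCR T
allCR₂ T σ =
  zero , (λ ()) , inj₂ (ℕ.≤-refl , agreeOrNot (σ (suc zero) Bool.≟ arc T zero (suc zero)))
  where
  onlyOther : ∀ {P : Fin 3 → Set} → P (suc (suc zero)) → ∀ v → v ≢ zero → v ≢ suc zero → P v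
  onlyOther p zero             0≢0 _   = ⊥-elim (0≢0 refl)
  onlyOther p (suc zero)       _   1≢1 = ⊥-elim (1≢1 refl)
  onlyOther p (suc (suc zero)) _   _   = p
  agreeOrNot : Dec (σ (suc zero) ≡ arc T zero (suc zero)) →
               Covertices (extend T σ) zero (suc zero) ⊎ Revertices (extend T σ) zero (suc zero)
  agreeOrNot (yes agree) = inj₁ (onlyOther agree)
  agreeOrNot (no  differ) = inj₂ (onlyOther (Bool.¬-not differ))

¬allCR₃ : (T : Tournament 3) → ¬ AllCR T
¬allCR₃ = toWitness {a? = ∀-tournament? resp (¬? ∘ allCR?)} tt
  where
  resp : ∀ {T T′ : Tournament 3} → T ≈ T′ → ¬ AllCR T → ¬ AllCR T′
  resp T≈T′ ¬all = ¬all ∘ allCR-resp (≈-sym T≈T′)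

diamond⇔allCR₄ : (T : Tournament 4) → IsDiamond T ⇔ AllCR T
diamond⇔allCR₄ T = mk⇔ (proj₁ (both T)) (proj₂ (both T))
  where
  both : ∀ T → (IsDiamond T → AllCR T) × (AllCR T → IsDiamond T)
  both = toWitness {a? = ∀-tournament? resp λ T →
                          (isDiamond? T →-dec allCR? T) ×-dec (allCR? T →-dec isDiamond? T)} tt
    where
    resp : ∀ {T T′ : Tournament 4} → T ≈ T′ →
           (IsDiamond T → AllCR T) × (AllCR T → IsDiamond T) →
           (IsDiamond T′ → AllCR T′) × (AllCR T′ → IsDiamond T′)
    resp T≈T′ (⇒ , ⇐) =
      allCR-resp T≈T′ ∘ ⇒ ∘ isDiamond-resp (≈-sym T≈T′) ,
      isDiamond-resp T≈T′ ∘ ⇐ ∘ allCR-resp (≈-sym T≈T′)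

CRParameters : ℕ → Set
CRParameters n = Fin n × Bool × Bool

-- Parameters (v , r , b): r = false for covertices, r = true for revertices, b = σ v.
crRelation : Tournament n → CRParameters n → DominatingRelation n
crRelation T (v , r , b) = updateAt (λ k → r xor arc T v k) v (const b)

≗-updateAt : ∀ {A : Set} {σ ρ : Fin n → A} v → (∀ k → k ≢ v → σ k ≡ ρ k) →
             σ ≗ updateAt ρ v (const (σ v))
≗-updateAt v agree k with k ≟ v
... | yes refl = sym (updateAt-updates k _)
... | no  k≢v  = trans (agree k k≢v) (sym (updateAt-minimal k v _ k≢v))

crRelation-complete : (T : Tournament n) (σ : DominatingRelation n) → IsCRVertex T σ →
                      Σ[ p ∈ CRParameters n ] σ ≗ crRelation T p
crRelation-complete T σ (zero    , _ , inj₁ refl) = (zero , false , σ zero) , λ { zero → refl }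
crRelation-complete T σ (suc () , _ , inj₁ refl)
crRelation-complete T σ (v , _ , inj₂ (_ , inj₁ co)) =
  (v , false , σ v) , ≗-updateAt v λ k k≢v → co (suc k) (λ ()) (k≢v ∘ suc-injective)
crRelation-complete T σ (v , _ , inj₂ (_ , inj₂ re)) =
  (v , true , σ v) , ≗-updateAt v λ k k≢v → re (suc k) (λ ()) (k≢v ∘ suc-injective)

encode : CRParameters n → Fin (n * (2 * 2))
encode (v , r , b) = combine v (combine (bit r) (bit b))

encode-injective : {p q : CRParameters n} → encode p ≡ encode q → p ≡ q
encode-injective {p = v , r , b} {v′ , r′ , b′} eq =
  let v≡v′ , rb≡r′b′ = combine-injective v _ v′ _ eq
      r≡r′ , b≡b′ = combine-injective (bit r) (bit b) (bit r′) (bit b′) rb≡r′b′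
  in cong₂ _,_ v≡v′ (cong₂ _,_ (bit-injective r≡r′) (bit-injective b≡b′))

allCR⇒2^n≤4n : (T : Tournament n) → AllCR T → 2 ^ n ≤ n * (2 * 2)
allCR⇒2^n≤4n {n} T all = injective⇒≤ {f = encode ∘ proj₁ ∘ parameters} parameters-injective
  where
  parameters : (i : Fin (2 ^ n)) → Σ[ p ∈ CRParameters n ] relation i ≗ crRelation T p
  parameters i = crRelation-complete T (relation i) (all (relation i))
  parameters-injective : ∀ {i j} →
                         encode (proj₁ (parameters i)) ≡ encode (proj₁ (parameters j)) → i ≡ j
  parameters-injective {i} {j} eq =
    let pᵢ , i≗pᵢ = parameters i
        pⱼ , j≗pⱼ = parameters j
    in relation-injective i j λ k → begin
      relation i k      ≡⟨ i≗pᵢ k ⟩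
      crRelation T pᵢ k ≡⟨ cong (λ p → crRelation T p k) (encode-injective {p = pᵢ} {pⱼ} eq) ⟩
      crRelation T pⱼ k ≡⟨ j≗pⱼ k ⟨
      relation j k      ∎
    where open ≡-Reasoning

4n<2^n : ∀ k → (5 + k) * 4 < 2 ^ (5 + k)
4n<2^n 0       = toWitness {a? = 20 ℕ.<? 32} tt
4n<2^n (suc k) = begin-strict
  4 + (5 + k) * 4           <⟨ ℕ.+-mono-< 4<2^n (4n<2^n k) ⟩
  2 ^ (5 + k) + 2 ^ (5 + k) ≡⟨ cong (2 ^ (5 + k) +_) (ℕ.+-identityʳ _) ⟨
  2 ^ (6 + k)               ∎
  where
  open ℕ.≤-Reasoning
  4<2^n : 4 < 2 ^ (5 + k)
  4<2^n = ℕ.≤-<-trans (ℕ.m≤m+n 4 ((4 + k) * 4)) (4n<2^n k)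

allCR-small-or-diamond : ∀ n (T : Tournament n) → n ≡ 1 ⊎ n ≡ 2 ⊎ IsDiamond T → AllCR T
allCR-small-or-diamond _ T (inj₁ refl)               σ = zero , (λ ()) , inj₁ refl
allCR-small-or-diamond _ T (inj₂ (inj₁ refl))          = allCR₂ T
allCR-small-or-diamond _ T (inj₂ (inj₂ d@(refl , _))) = Equivalence.to (diamond⇔allCR₄ T) d

¬diamond⇒¬allCR : ∀ n (T : Tournament n) → n ≥ 3 → ¬ IsDiamond T → ¬ AllCR T
¬diamond⇒¬allCR 3 T _ _       = ¬allCR₃ T
¬diamond⇒¬allCR 4 T _ ¬dia    = ¬dia ∘ Equivalence.from (diamond⇔allCR₄ T)
¬diamond⇒¬allCR (suc (suc (suc (suc (suc k))))) T _ _ all = ℕ.<⇒≱ (4n<2^n k) (allCR⇒2^n≤4n T all)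
¬diamond⇒¬allCR 0 T () _
¬diamond⇒¬allCR 1 T (s≤s ()) _
¬diamond⇒¬allCR 2 T (s≤s (s≤s ())) _

proposition2p4 : (n : ℕ) (T : Tournament n) →
    ((n ≡ 1 ⊎ n ≡ 2 ⊎ IsDiamond T) → (σ : DominatingRelation n) → IsCRVertex T σ) ×
    (n ≥ 3 → ¬ IsDiamond T → ∃[ σ ] ¬ IsCRVertex T σ)
proposition2p4 n T =
  allCR-small-or-diamond n T ,
  λ n≥3 ¬dia → ¬allCR⇒nonCR T (¬diamond⇒¬allCR n T n≥3 ¬dia)
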